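{- Let $G$ be a finite simple graph and $k\ge 3$ an integer. If $\chi_c(G)<k$ then $G\in\mathcal{C}_{k+1}$.
   Context: A circular ordering of a finite set $X$ is a ternary relation $C\subseteq X^3$ such that for all $x,y,z,w\in X$: $(x,y,z)\in C\Rightarrow(y,z,x)\in C$; $(x,y,z)\in C\Rightarrow(x,z,y)\notin C$; $(x,y,z),(x,z,w)\in C\Rightarrow(x,y,w)\in C$; and for distinct $x,y,z$ either $(x,y,z)\in C$ or $(x,z,y)\in C$. For $n\ge 2$ and a graph $G$ with circular ordering $C$ of $V(G)$, write $SP_n\to(G,C)$ if there exist vertices $u_1,\dots,u_n$ with $u_iu_{i+1}\in E(G)$ for $1\le i\le n-1$, $u_1,\dots,u_{n-1}$ pairwise distinct with $(u_1,u_i,u_j)\in C$ whenever $1<i<j\le n-1$, and either $u_n=u_1$ or ($u_n\notin\{u_1,\dots,u_{n-1}\}$ and $(u_{n-1},u_n,u_1)\in C$). $\mathcal{C}_n$ is the class of graphs $G$ admitting a circular ordering $C$ of $V(G)$ with $SP_n\not\to(G,C)$. For positive integers $q\le p$, $K_{p/q}$ is the graph on $\{0,\dots,p-1\}$ with $ij\in E$ iff $\min(|i-j|,p-|i-j|)\ge q$; $\chi_c(G)=\inf\{p/q: q\le p\le|V(G)|,\ G\to K_{p/q}\}$ ($\to$ = graph homomorphism exists). -}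

module Defs where

open import Level using (0ℓ)
open import Data.Nat using (ℕ; zero; suc; _+_; _*_; _∸_; _≤_; _<_; _⊓_; ∣_-_∣)
open import Data.Fin using (Fin; toℕ)
open import Data.Product using (Σ; ∃; ∃-syntax; _×_; _,_)
open import Data.Sum using (_⊎_)
open import Relation.Nullary using (¬_)
open import Relation.Binary.PropositionalEquality using (_≡_; _≢_)

record Graph : Set₁ where
  field
    n      : ℕ
    Adj    : Fin n → Fin n → Set
    sym    : ∀ {x y} → Adj x y → Adj y x
    irrefl : ∀ {x} → ¬ Adj x x
open Graph public

cdist : ∀ {p} → Fin p → Fin p → ℕ
cdist {p} i j = ∣ toℕ i - toℕ j ∣ ⊓ (p ∸ ∣ toℕ i - toℕ j ∣)

KAdj : (p q : ℕ) → Fin p → Fin p → Set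
KAdj p q i j = q ≤ cdist i j

HomK : Graph → (p q : ℕ) → Set
HomK G p q = Σ (Fin (n G) → Fin p) λ f →
  ∀ {x y} → Adj G x y → KAdj p q (f x) (f y)

-- χ_c(G) < k.  χ_c(G) is the infimum of the finite set
-- { p/q : 1 ≤ q ≤ p ≤ |V(G)|, G → K_{p/q} }, hence (when nonempty) its minimum,
-- so χ_c(G) < k iff some admissible p/q satisfies p/q < k, i.e. p < k*q.
-- (If the set is empty, χ_c = inf ∅ = +∞ and χ_c < k is false.)
ChiCLess : Graph → ℕ → Set
ChiCLess G k = ∃[ p ] ∃[ q ] (1 ≤ q × q ≤ p × p ≤ n G × HomK G p q × p < k * q)

record IsCircularOrdering {m : ℕ} (C : Fin m → Fin m → Fin m → Set) : Set where
  field
    cyclic   : ∀ {x y z} → C x y z → C y z x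
    asym     : ∀ {x y z} → C x y z → ¬ C x z y
    trans    : ∀ {x y z w} → C x y z → C x z w → C x y w
    total    : ∀ {x y z} → x ≢ y → y ≢ z → x ≢ z → C x y z ⊎ C x z y

-- SP_m → (G , C), with the walk u indexed 1,…,m (values of u outside are irrelevant).
SP→ : (m : ℕ) (G : Graph) → (Fin (n G) → Fin (n G) → Fin (n G) → Set) → Set
SP→ m G C = Σ (ℕ → Fin (n G)) λ u →
    (∀ i → 1 ≤ i → i + 1 ≤ m → Adj G (u i) (u (suc i)))
  × (∀ i j → 1 ≤ i → i < j → j ≤ m ∸ 1 → u i ≢ u j)
  × (∀ i j → 1 < i → i < j → j ≤ m ∸ 1 → C (u 1) (u i) (u j))
  × (u m ≡ u 1
     ⊎ ((∀ i → 1 ≤ i → i ≤ m ∸ 1 → u m ≢ u i) × C (u (m ∸ 1)) (u m) (u 1)))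

InC : ℕ → Graph → Set₁
InC m G = Σ (Fin (n G) → Fin (n G) → Fin (n G) → Set) λ C →
  IsCircularOrdering C × ¬ SP→ m G C

{-# OPTIONS --safe #-}
-- Fix a homomorphism f : G → K_{p/q} with p < k q and order the vertices circularly by
-- (colour, index). Seen from a base vertex b, unroll this circle onto a line: a vertex z
-- keeps its colour c(z) if it comes after b and gets c(z) + p if it comes before b.
-- Along an SP-walk from b the lifted colours are nondecreasing, hence grow by at least q
-- across each edge (adjacent colours are at circular distance ≥ q), while the k-th edge
-- ends at lifted colour at most c(b) + p. So k q ≤ p.
module Submission where

open import Defs
open import Data.Nat using (ℕ; suc; _≤_)
open import Data.Nat.Base using (zero; _+_; _*_; _∸_; _<_; _⊓_; ∣_-_∣; z≤n; s≤s)
open import Data.Nat.Properties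
open import Data.Fin using (Fin; toℕ; combine)
open import Data.Fin.Properties using (toℕ-injective; toℕ<n; combine-monoˡ-<; combine-injectiveʳ)
open import Data.Product using (_×_; _,_; proj₁; proj₂)
open import Data.Sum as Sum using (_⊎_; inj₁; inj₂)
open import Data.Empty using (⊥-elim)
open import Function using (_∘_)
open import Function.Definitions using (Injective)
open import Relation.Nullary using (¬_; yes; no; contradiction)
open import Relation.Binary using (tri<; tri≈; tri>)
open import Relation.Binary.PropositionalEquality using (_≡_; _≢_; refl; subst; module ≡-Reasoning)
  renaming (sym to ≡-sym)

Cyclic : ℕ → ℕ → ℕ → Set
Cyclic a b c = (a < b × b < c) ⊎ (b < c × c < a) ⊎ (c < a × a < b)

Cyclic-rotate : ∀ {a b c} → Cyclic a b c → Cyclic b c a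
Cyclic-rotate (inj₁ h)        = inj₂ (inj₂ h)
Cyclic-rotate (inj₂ (inj₁ h)) = inj₁ h
Cyclic-rotate (inj₂ (inj₂ h)) = inj₂ (inj₁ h)

Cyclic-asym : ∀ {a b c} → Cyclic a b c → ¬ Cyclic a c b
Cyclic-asym (inj₁ (a<b , b<c))        (inj₁ (a<c , c<b))        = <-asym b<c c<b
Cyclic-asym (inj₁ (a<b , b<c))        (inj₂ (inj₁ (c<b , b<a))) = <-asym a<b b<a
Cyclic-asym (inj₁ (a<b , b<c))        (inj₂ (inj₂ (b<a , a<c))) = <-asym a<b b<a
Cyclic-asym (inj₂ (inj₁ (b<c , c<a))) (inj₁ (a<c , c<b))        = <-asym c<a a<c
Cyclic-asym (inj₂ (inj₁ (b<c , c<a))) (inj₂ (inj₁ (c<b , b<a))) = <-asym b<c c<b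
Cyclic-asym (inj₂ (inj₁ (b<c , c<a))) (inj₂ (inj₂ (b<a , a<c))) = <-asym c<a a<c
Cyclic-asym (inj₂ (inj₂ (c<a , a<b))) (inj₁ (a<c , c<b))        = <-asym c<a a<c
Cyclic-asym (inj₂ (inj₂ (c<a , a<b))) (inj₂ (inj₁ (c<b , b<a))) = <-asym a<b b<a
Cyclic-asym (inj₂ (inj₂ (c<a , a<b))) (inj₂ (inj₂ (b<a , a<c))) = <-asym a<b b<a

Cyclic-trans : ∀ {a b c d} → Cyclic a b c → Cyclic a c d → Cyclic a b d
Cyclic-trans (inj₁ (a<b , b<c))        (inj₁ (a<c , c<d))        = inj₁ (a<b , <-trans b<c c<d)
Cyclic-trans (inj₁ (a<b , b<c))        (inj₂ (inj₁ (c<d , d<a))) =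
  ⊥-elim (<-asym (<-trans a<b b<c) (<-trans c<d d<a))
Cyclic-trans (inj₁ (a<b , b<c))        (inj₂ (inj₂ (d<a , a<c))) = inj₂ (inj₂ (d<a , a<b))
Cyclic-trans (inj₂ (inj₁ (b<c , c<a))) (inj₁ (a<c , c<d))        = ⊥-elim (<-asym c<a a<c)
Cyclic-trans (inj₂ (inj₁ (b<c , c<a))) (inj₂ (inj₁ (c<d , d<a))) = inj₂ (inj₁ (<-trans b<c c<d , d<a))
Cyclic-trans (inj₂ (inj₁ (b<c , c<a))) (inj₂ (inj₂ (d<a , a<c))) = ⊥-elim (<-asym c<a a<c)
Cyclic-trans (inj₂ (inj₂ (c<a , a<b))) (inj₁ (a<c , c<d))        = ⊥-elim (<-asym c<a a<c)
Cyclic-trans (inj₂ (inj₂ (c<a , a<b))) (inj₂ (inj₁ (c<d , d<a))) = inj₂ (inj₂ (d<a , a<b))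
Cyclic-trans (inj₂ (inj₂ (c<a , a<b))) (inj₂ (inj₂ (d<a , a<c))) = ⊥-elim (<-asym c<a a<c)

Cyclic-total : ∀ {a b c} → a ≢ b → b ≢ c → a ≢ c → Cyclic a b c ⊎ Cyclic a c b
Cyclic-total {a} {b} {c} a≢b b≢c a≢c with <-cmp a b | <-cmp b c | <-cmp a c
... | tri≈ _ a≡b _ | _            | _            = contradiction a≡b a≢b
... | _            | tri≈ _ b≡c _ | _            = contradiction b≡c b≢c
... | _            | _            | tri≈ _ a≡c _ = contradiction a≡c a≢c
... | tri< a<b _ _ | tri< b<c _ _ | _            = inj₁ (inj₁ (a<b , b<c))
... | tri< a<b _ _ | tri> _ _ c<b | tri< a<c _ _ = inj₂ (inj₁ (a<c , c<b))
... | tri< a<b _ _ | tri> _ _ c<b | tri> _ _ c<a = inj₁ (inj₂ (inj₂ (c<a , a<b)))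
... | tri> _ _ b<a | tri< b<c _ _ | tri< a<c _ _ = inj₂ (inj₂ (inj₂ (b<a , a<c)))
... | tri> _ _ b<a | tri< b<c _ _ | tri> _ _ c<a = inj₁ (inj₂ (inj₁ (b<c , c<a)))
... | tri> _ _ b<a | tri> _ _ c<b | _            = inj₂ (inj₂ (inj₁ (c<b , b<a)))

injective⇒isCircularOrdering : ∀ {m} {r : Fin m → ℕ} → Injective _≡_ _≡_ r →
                               IsCircularOrdering (λ x y z → Cyclic (r x) (r y) (r z))
injective⇒isCircularOrdering r-injective = record
  { cyclic = Cyclic-rotate
  ; asym   = Cyclic-asym
  ; trans  = Cyclic-trans
  ; total  = λ x≢y y≢z x≢z →
      Cyclic-total (x≢y ∘ r-injective) (y≢z ∘ r-injective) (x≢z ∘ r-injective)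
  }

IsLift : ℕ → ℕ → ℕ → Set
IsLift p x e = e ≡ x ⊎ e ≡ p + x

distance-gap : ∀ {q x y} → x ≤ y → q ≤ ∣ x - y ∣ → x + q ≤ y
distance-gap {q} {x} {y} x≤y q≤d = begin
  x + q       ≤⟨ +-monoʳ-≤ x (subst (q ≤_) (m≤n⇒∣m-n∣≡n∸m x≤y) q≤d) ⟩
  x + (y ∸ x) ≡⟨ m+[n∸m]≡n x≤y ⟩
  y           ∎
  where open ≤-Reasoning

wrap-gap : ∀ {p q x y} → x < p → y < p → q ≤ ∣ x - y ∣ ⊓ (p ∸ ∣ x - y ∣) → x + q ≤ p + y
wrap-gap {p} {q} {x} {y} x<p y<p q≤cdist = begin
  x + q               ≤⟨ +-monoˡ-≤ q (m≤n+∣m-n∣ x y) ⟩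
  y + ∣ x - y ∣ + q   ≡⟨ +-assoc y _ q ⟩
  y + (∣ x - y ∣ + q) ≡⟨ +-comm y _ ⟩
  ∣ x - y ∣ + q + y   ≤⟨ +-monoˡ-≤ y (subst (_≤ p) (+-comm q _) q+d≤p) ⟩
  p + y               ∎
  where
  open ≤-Reasoning
  d≤p : ∣ x - y ∣ ≤ p
  d≤p = ≤-trans (∣m-n∣≤m⊔n x y) (⊔-lub (<⇒≤ x<p) (<⇒≤ y<p))
  q+d≤p : q + ∣ x - y ∣ ≤ p
  q+d≤p = m≤o∸n⇒m+n≤o q d≤p (m≤n⊓o⇒m≤o _ _ q≤cdist)

lift-gap : ∀ {p q} {i j : Fin p} {ei ej} → KAdj p q i j →
           IsLift p (toℕ i) ei → IsLift p (toℕ j) ej → ei ≤ ej → ei + q ≤ ej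
lift-gap adj (inj₁ refl) (inj₁ refl) le = distance-gap le (m≤n⊓o⇒m≤n _ _ adj)
lift-gap {p} {i = i} {j} adj (inj₂ refl) (inj₂ refl) le = distance-gap le
  (subst (_ ≤_) (≡-sym (∣m+n-m+o∣≡∣n-o∣ p (toℕ i) (toℕ j))) (m≤n⊓o⇒m≤n _ _ adj))
lift-gap {p} {j = j} adj (inj₂ refl) (inj₁ refl) le =
  contradiction (≤-trans (m≤m+n p _) le) (<⇒≱ (toℕ<n j))
lift-gap {i = i} {j} adj (inj₁ refl) (inj₂ refl) _ = wrap-gap (toℕ<n i) (toℕ<n j) adj

progression-bound : ∀ {q} (e : ℕ → ℕ) m →
                    (∀ i → i < m → e i + q ≤ e (suc i)) → m * q + e 0 ≤ e m
progression-bound e zero    _    = ≤-refl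
progression-bound {q} e (suc m) step = begin
  q + m * q + e 0   ≡⟨ +-assoc q (m * q) (e 0) ⟩
  q + (m * q + e 0) ≤⟨ +-monoʳ-≤ q (progression-bound e m (λ i → step i ∘ m<n⇒m<1+n)) ⟩
  q + e m           ≡⟨ +-comm q (e m) ⟩
  e m + q           ≤⟨ step m ≤-refl ⟩
  e (suc m)         ∎
  where open ≤-Reasoning

module ColourOrder {m p : ℕ} (f : Fin m → Fin p) where

  colour : Fin m → ℕ
  colour z = toℕ (f z)

  rank : Fin m → ℕ
  rank z = toℕ (combine (f z) z)

  rank-injective : Injective _≡_ _≡_ rank
  rank-injective {x} {y} eq = combine-injectiveʳ (f x) x (f y) y (toℕ-injective eq)

  colour-mono : ∀ {x y} → rank x ≤ rank y → colour x ≤ colour y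
  colour-mono {x} {y} rx≤ry = ≮⇒≥ (λ cy<cx → <⇒≱ (combine-monoˡ-< y x cy<cx) rx≤ry)

  colour≤p+ : ∀ x c → colour x ≤ p + c
  colour≤p+ x c = <⇒≤ (<-≤-trans (toℕ<n (f x)) (m≤m+n p c))

  ordering : Fin m → Fin m → Fin m → Set
  ordering x y z = Cyclic (rank x) (rank y) (rank z)

  ordering-isCircularOrdering : IsCircularOrdering ordering
  ordering-isCircularOrdering = injective⇒isCircularOrdering rank-injective

  module Lifted (b : Fin m) where

    lift : Fin m → ℕ
    lift z with rank z <? rank b
    ... | yes _ = p + colour z
    ... | no  _ = colour z

    lift-isLift : ∀ z → IsLift p (colour z) (lift z)
    lift-isLift z with rank z <? rank b
    ... | yes _ = inj₂ refl
    ... | no  _ = inj₁ refl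

    lift-below : ∀ {z} → rank z < rank b → lift z ≡ p + colour z
    lift-below {z} z<b with rank z <? rank b
    ... | yes _   = refl
    ... | no  z≮b = contradiction z<b z≮b

    lift-above : ∀ {z} → rank b ≤ rank z → lift z ≡ colour z
    lift-above {z} b≤z with rank z <? rank b
    ... | yes z<b = contradiction b≤z (<⇒≱ z<b)
    ... | no  _   = refl

    lift-base : lift b ≡ colour b
    lift-base = lift-above ≤-refl

    lift-base≤ : ∀ y → lift b ≤ lift y
    lift-base≤ y rewrite lift-base with rank y <? rank b
    ... | yes _   = colour≤p+ b (colour y)
    ... | no  y≮b = colour-mono (≮⇒≥ y≮b)

    lift≤p+base : ∀ x → lift x ≤ p + colour b
    lift≤p+base x with rank x <? rank b
    ... | yes x<b = +-monoʳ-≤ p (colour-mono (<⇒≤ x<b))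
    ... | no  _   = colour≤p+ x (colour b)

    lift-mono : ∀ {x y} → ordering b x y → lift x ≤ lift y
    lift-mono {x} {y} (inj₁ (b<x , x<y)) = begin
      lift x   ≡⟨ lift-above (<⇒≤ b<x) ⟩
      colour x ≤⟨ colour-mono (<⇒≤ x<y) ⟩
      colour y ≡⟨ ≡-sym (lift-above (<⇒≤ (<-trans b<x x<y))) ⟩
      lift y   ∎
      where open ≤-Reasoning
    lift-mono {x} {y} (inj₂ (inj₁ (x<y , y<b))) = begin
      lift x       ≡⟨ lift-below (<-trans x<y y<b) ⟩
      p + colour x ≤⟨ +-monoʳ-≤ p (colour-mono (<⇒≤ x<y)) ⟩
      p + colour y ≡⟨ ≡-sym (lift-below y<b) ⟩
      lift y       ∎
      where open ≤-Reasoning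
    lift-mono {x} {y} (inj₂ (inj₂ (y<b , b<x))) = begin
      lift x       ≡⟨ lift-above (<⇒≤ b<x) ⟩
      colour x     ≤⟨ colour≤p+ x (colour y) ⟩
      p + colour y ≡⟨ ≡-sym (lift-below y<b) ⟩
      lift y       ∎
      where open ≤-Reasoning

module Homomorphism (G : Graph) {p q : ℕ} (h : HomK G p q) where
  open ColourOrder (proj₁ h) public

  module LiftedEdges (b : Fin (n G)) where
    open Lifted b public

    lift-step : ∀ {x y} → Adj G x y → lift x ≤ lift y → lift x + q ≤ lift y
    lift-step x~y = lift-gap (proj₂ h x~y) (lift-isLift _) (lift-isLift _)

    lift-step-to-base : ∀ {x y} → Adj G x y → y ≡ b ⊎ ordering x y b → lift x + q ≤ p + colour b
    lift-step-to-base x~b (inj₁ refl) =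
      lift-gap (proj₂ h x~b) (lift-isLift _) (inj₂ refl) (lift≤p+base _)
    lift-step-to-base x~y (inj₂ xyb)  =
      ≤-trans (lift-step x~y (lift-mono (Cyclic-rotate (Cyclic-rotate xyb)))) (lift≤p+base _)

  ordering-avoids-SP : ∀ k → p < k * q → ¬ SP→ (suc k) G ordering
  ordering-avoids-SP zero    ()
  ordering-avoids-SP (suc k) p<kq (u , adj , _ , ord , end) = <⇒≱ p<kq kq≤p
    where
    b : Fin (n G)
    b = u 1
    open LiftedEdges b

    edge : ∀ i → i ≤ k → Adj G (u (suc i)) (u (suc (suc i)))
    edge i i≤k = adj (suc i) (s≤s z≤n) (s≤s (subst (_≤ suc k) (+-comm 1 i) (s≤s i≤k)))

    walk-mono : ∀ i → i < k → lift (u (suc i)) ≤ lift (u (suc (suc i)))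
    walk-mono zero    _   = lift-base≤ _
    walk-mono (suc i) i<k =
      lift-mono (ord (suc (suc i)) (suc (suc (suc i))) (s≤s (s≤s z≤n)) ≤-refl (s≤s i<k))

    climb : k * q + colour b ≤ lift (u (suc k))
    climb = subst (λ c → k * q + c ≤ lift (u (suc k))) lift-base
      (progression-bound (λ i → lift (u (suc i))) k
        (λ i i<k → lift-step (edge i (<⇒≤ i<k)) (walk-mono i i<k)))

    kq≤p : suc k * q ≤ p
    kq≤p = +-cancelʳ-≤ (colour b) _ _ (begin
      q + k * q + colour b   ≡⟨ +-assoc q (k * q) (colour b) ⟩
      q + (k * q + colour b) ≤⟨ +-monoʳ-≤ q climb ⟩
      q + lift (u (suc k))   ≡⟨ +-comm q _ ⟩
      lift (u (suc k)) + q   ≤⟨ lift-step-to-base (edge k ≤-refl) (Sum.map₂ proj₂ end) ⟩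
      p + colour b           ∎)
      where open ≤-Reasoning

-- The argument works for every k.
mainTheorem12 : (G : Graph) (k : ℕ) → 3 ≤ k → ChiCLess G k → InC (suc k) G
mainTheorem12 G k _ (p , q , _ , _ , _ , h , p<kq) =
  ordering , ordering-isCircularOrdering , ordering-avoids-SP k p<kq
  where open Homomorphism G h
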